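{- (i) The polynomial sequence $\left\{\sum_{k=0}^n\mathrm{JS}(n,k;z)y^k\right\}_{n\geq0}$ is strongly $\{z,y\}$-log-convex. (ii) The polynomial sequence $\left\{\sum_{k=0}^n\mathrm{js}(n,k;z)y^k\right\}_{n\geq0}$ is strongly $\{z,y\}$-log-convex.
   Context: The Jacobi-Stirling numbers of the first kind $\mathrm{js}(n,k;z)$ and of the second kind $\mathrm{JS}(n,k;z)$ ($n\geq k\geq 0$) are defined by $\mathrm{js}(n,k;z)=\mathrm{js}(n-1,k-1;z)+(n-1)(n-1+z)\mathrm{js}(n-1,k;z)$ and $\mathrm{JS}(n,k;z)=\mathrm{JS}(n-1,k-1;z)+k(k+z)\mathrm{JS}(n-1,k;z)$, with $\mathrm{JS}(0,0;z)=\mathrm{js}(0,0;z)=1$ and $\mathrm{JS}(j,0;z)=\mathrm{JS}(0,j;z)=\mathrm{js}(j,0;z)=\mathrm{js}(0,j;z)=0$ for $j\geq1$. A sequence $\{f_n\}$ of polynomials in $\mathbb R_+[z,y]$ is strongly $\{z,y\}$-log-convex if $f_{k-1}f_{l+1}-f_kf_l\in\mathbb R_+[z,y]$ for all $l\geq k\geq1$. -}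

module Defs where

open import Data.Nat using (ℕ; zero; suc; _∸_; _≤_; _≤?_)
open import Data.Integer using (ℤ; +_; _+_; _*_; _-_; 0ℤ)
  renaming (_≤_ to _≤ℤ_)
open import Data.Product using (_×_)
open import Relation.Nullary using (yes; no)

-- Univariate polynomial in z with integer coefficients, given by its
-- coefficient function (i ↦ coefficient of z^i).  All polynomials built
-- below have finite support.
PolyZ : Set
PolyZ = ℕ → ℤ

-- Bivariate polynomial in z, y: (i , j) ↦ coefficient of z^i y^j.
Poly2 : Set
Poly2 = ℕ → ℕ → ℤ

zeroZ : PolyZ
zeroZ _ = 0ℤ

oneZ : PolyZ
oneZ zero    = + 1
oneZ (suc _) = 0ℤ

_+Z_ : PolyZ → PolyZ → PolyZ
(p +Z q) i = p i + q i

-- multiplication by the polynomial  m (m + z)  (m a natural number)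
mulLin : ℕ → PolyZ → PolyZ
mulLin m p zero    = (+ m) * (+ m) * p zero
mulLin m p (suc i) = (+ m) * (+ m) * p (suc i) + (+ m) * p i

JS : ℕ → ℕ → PolyZ
JS zero    zero    = oneZ
JS zero    (suc k) = zeroZ
JS (suc n) zero    = zeroZ
JS (suc n) (suc k) = JS n k +Z mulLin (suc k) (JS n (suc k))

js : ℕ → ℕ → PolyZ
js zero    zero    = oneZ
js zero    (suc k) = zeroZ
js (suc n) zero    = zeroZ
js (suc n) (suc k) = js n k +Z mulLin n (js n (suc k))

-- Row generating polynomial  Σ_{k=0}^{n} T(n,k;z) y^k  as a bivariate polynomial
rowPoly : (ℕ → ℕ → PolyZ) → ℕ → Poly2
rowPoly T n i j with j ≤? n
... | yes _ = T n j i
... | no  _ = 0ℤ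

sumTo : ℕ → (ℕ → ℤ) → ℤ
sumTo zero    f = f zero
sumTo (suc n) f = sumTo n f + f (suc n)

_*P_ : Poly2 → Poly2 → Poly2
(p *P q) a b = sumTo a (λ i → sumTo b (λ j → p i j * q (a ∸ i) (b ∸ j)))

_-P_ : Poly2 → Poly2 → Poly2
(p -P q) a b = p a b - q a b

Nonneg : Poly2 → Set
Nonneg p = ∀ a b → 0ℤ ≤ℤ p a b

StronglyLogConvex : (ℕ → Poly2) → Set
StronglyLogConvex f =
  (∀ n → Nonneg (f n)) ×
  (∀ k l → 1 ≤ k → k ≤ l →
     Nonneg ((f (k ∸ 1) *P f (suc l)) -P (f k *P f l)))

-- Both triangles satisfy a recurrence  T(n+1,b) = T(n,b-1) + w(n,b)(w(n,b)+z) T(n,b)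
-- (w = n for js, w = b for JS).  Multiplying by y makes the T(n,b-1) parts of
-- f_m f_{n+1} and f_{m+1} f_n coincide, so their difference is
--   Σ_{a+b=s} [w(n,b)(w(n,b)+z) − w(m,a)(w(m,a)+z)] T(m,a) T(n,b)
-- in degree s of y.  For js every bracket is a polynomial with nonnegative
-- coefficients since m ≤ n.  For JS, pairing the terms (a,b) and (b,a) leaves
-- [b(b+z) − a(a+z)] times the minor T(m,a)T(n,b) − T(m,b)T(n,a), which is
-- nonnegative for m ≤ n, a ≤ b by induction along the recurrence.

module Submission where

open import Defs
open import Data.Product using (_×_; _,_)
open import Data.Sum using (inj₁; inj₂)
open import Data.Nat as ℕ using (ℕ; zero; suc; _∸_; _≤_; _<_; z≤n; s≤s)
import Data.Nat.Properties as ℕ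
open import Data.Integer as ℤ using (ℤ; +_; _+_; _*_; _-_; 0ℤ)
  renaming (_≤_ to _≤ℤ_)
import Data.Integer.Properties as ℤ
open import Algebra.Properties.CommutativeSemigroup ℤ.+-commutativeSemigroup
  using (interchange)
open import Algebra.Properties.CommutativeSemigroup ℤ.*-commutativeSemigroup
  using (x∙yz≈y∙xz)
open import Data.Integer.Tactic.RingSolver using (solve-∀)
open import Relation.Binary.PropositionalEquality
open import Relation.Nullary using (yes; no)

-- Finite sums

sumTo-cong : ∀ n {f g : ℕ → ℤ} → (∀ i → i ≤ n → f i ≡ g i) → sumTo n f ≡ sumTo n g
sumTo-cong zero    f≡g = f≡g zero z≤n
sumTo-cong (suc n) f≡g =
  cong₂ _+_ (sumTo-cong n (λ i i≤n → f≡g i (ℕ.m≤n⇒m≤1+n i≤n))) (f≡g (suc n) ℕ.≤-refl)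

sumTo-cong′ : ∀ n {f g : ℕ → ℤ} → f ≗ g → sumTo n f ≡ sumTo n g
sumTo-cong′ n f≗g = sumTo-cong n (λ i _ → f≗g i)

sumTo-distrib-+ : ∀ n (f g : ℕ → ℤ) → sumTo n (λ i → f i + g i) ≡ sumTo n f + sumTo n g
sumTo-distrib-+ zero    f g = refl
sumTo-distrib-+ (suc n) f g rewrite sumTo-distrib-+ n f g =
  interchange (sumTo n f) (sumTo n g) (f (suc n)) (g (suc n))

sumTo-distrib-- : ∀ n (f g : ℕ → ℤ) → sumTo n (λ i → f i - g i) ≡ sumTo n f - sumTo n g
sumTo-distrib-- zero    f g = refl
sumTo-distrib-- (suc n) f g rewrite sumTo-distrib-- n f g =
  regroup (sumTo n f) (sumTo n g) (f (suc n)) (g (suc n))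
  where
  regroup : ∀ a b c d → a - b + (c - d) ≡ a + c - (b + d)
  regroup = solve-∀

sumTo-*ˡ : ∀ n (c : ℤ) (f : ℕ → ℤ) → sumTo n (λ i → c * f i) ≡ c * sumTo n f
sumTo-*ˡ zero    c f = refl
sumTo-*ˡ (suc n) c f rewrite sumTo-*ˡ n c f = sym (ℤ.*-distribˡ-+ c (sumTo n f) (f (suc n)))

sumTo-zero : ∀ n {f : ℕ → ℤ} → (∀ i → f i ≡ 0ℤ) → sumTo n f ≡ 0ℤ
sumTo-zero zero    f≡0 = f≡0 zero
sumTo-zero (suc n) f≡0 rewrite sumTo-zero n f≡0 | f≡0 (suc n) = refl

sumTo-suc-first : ∀ n (f : ℕ → ℤ) → sumTo (suc n) f ≡ f zero + sumTo n (λ i → f (suc i))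
sumTo-suc-first zero    f = refl
sumTo-suc-first (suc n) f rewrite sumTo-suc-first n f = ℤ.+-assoc (f zero) _ _

sumTo-reverse : ∀ n (f : ℕ → ℤ) → sumTo n f ≡ sumTo n (λ i → f (n ∸ i))
sumTo-reverse zero    f = refl
sumTo-reverse (suc n) f = begin
  sumTo n f + f (suc n)                      ≡⟨ cong (_+ f (suc n)) (sumTo-reverse n f) ⟩
  sumTo n (λ i → f (n ∸ i)) + f (suc n)      ≡⟨ ℤ.+-comm _ (f (suc n)) ⟩
  f (suc n) + sumTo n (λ i → f (n ∸ i))      ≡⟨ sym (sumTo-suc-first n (λ i → f (suc n ∸ i))) ⟩
  sumTo (suc n) (λ i → f (suc n ∸ i))        ∎
  where open ≡-Reasoning

sumTo-swap : ∀ n m (h : ℕ → ℕ → ℤ) →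
  sumTo n (λ i → sumTo m (λ j → h i j)) ≡ sumTo m (λ j → sumTo n (λ i → h i j))
sumTo-swap zero    m h = refl
sumTo-swap (suc n) m h rewrite sumTo-swap n m h =
  sym (sumTo-distrib-+ m (λ j → sumTo n (λ i → h i j)) (λ j → h (suc n) j))

0≤+ : ∀ n → 0ℤ ≤ℤ + n
0≤+ n = ℤ.+≤+ z≤n

+-nonNeg : ∀ {i j} → 0ℤ ≤ℤ i → 0ℤ ≤ℤ j → 0ℤ ≤ℤ i + j
+-nonNeg {i} {j} 0≤i 0≤j = ℤ.+-mono-≤ {0ℤ} {i} {0ℤ} {j} 0≤i 0≤j

*-nonNeg : ∀ {i j} → 0ℤ ≤ℤ i → 0ℤ ≤ℤ j → 0ℤ ≤ℤ i * j
*-nonNeg {+ m} {+ n} _ _ = subst (0ℤ ≤ℤ_) (ℤ.pos-* m n) (0≤+ (m ℕ.* n))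

0≤i+i⇒0≤i : ∀ {i} → 0ℤ ≤ℤ i + i → 0ℤ ≤ℤ i
0≤i+i⇒0≤i {+ n}      _  = 0≤+ n
0≤i+i⇒0≤i {ℤ.-[1+ n ]} ()

sumTo-nonNeg : ∀ n {f : ℕ → ℤ} → (∀ i → i ≤ n → 0ℤ ≤ℤ f i) → 0ℤ ≤ℤ sumTo n f
sumTo-nonNeg zero    f≥0 = f≥0 zero z≤n
sumTo-nonNeg (suc n) f≥0 =
  +-nonNeg (sumTo-nonNeg n (λ i i≤n → f≥0 i (ℕ.m≤n⇒m≤1+n i≤n))) (f≥0 (suc n) ℕ.≤-refl)

sumTo-nonNeg-symmetric : ∀ n (f : ℕ → ℤ) →
  (∀ i → i ≤ n → 0ℤ ≤ℤ f i + f (n ∸ i)) → 0ℤ ≤ℤ sumTo n f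
sumTo-nonNeg-symmetric n f pairs≥0 =
  0≤i+i⇒0≤i (subst (0ℤ ≤ℤ_) doubled (sumTo-nonNeg n pairs≥0))
  where
  doubled : sumTo n (λ i → f i + f (n ∸ i)) ≡ sumTo n f + sumTo n f
  doubled = trans (sumTo-distrib-+ n f (λ i → f (n ∸ i)))
                  (cong (_+_ (sumTo n f)) (sym (sumTo-reverse n f)))

-- Polynomials in z

infix  25 _*Z_
infixl 30 _·Z_

_-Z_ : PolyZ → PolyZ → PolyZ
(p -Z q) i = p i - q i

_·Z_ : ℤ → PolyZ → PolyZ
(c ·Z p) i = c * p i

_*Z_ : PolyZ → PolyZ → PolyZ
(p *Z q) t = sumTo t (λ i → p i * q (t ∸ i))

shiftZ : PolyZ → PolyZ
shiftZ p zero    = 0ℤ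
shiftZ p (suc i) = p i

NonNegZ : PolyZ → Set
NonNegZ p = ∀ i → 0ℤ ≤ℤ p i

*Z-cong : ∀ {p p′ q q′} → p ≗ p′ → q ≗ q′ → p *Z q ≗ p′ *Z q′
*Z-cong p≗p′ q≗q′ t = sumTo-cong′ t (λ i → cong₂ _*_ (p≗p′ i) (q≗q′ (t ∸ i)))

*Z-comm : ∀ p q → p *Z q ≗ q *Z p
*Z-comm p q t = begin
  sumTo t (λ i → p i * q (t ∸ i))                ≡⟨ sumTo-reverse t _ ⟩
  sumTo t (λ i → p (t ∸ i) * q (t ∸ (t ∸ i)))    ≡⟨ sumTo-cong t (λ i i≤t →
      trans (cong (λ k → p (t ∸ i) * q k) (ℕ.m∸[m∸n]≡n i≤t)) (ℤ.*-comm (p (t ∸ i)) (q i))) ⟩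
  sumTo t (λ i → q i * p (t ∸ i))                ∎
  where open ≡-Reasoning

*Z-distribˡ-+Z : ∀ p q r → p *Z (q +Z r) ≗ (p *Z q) +Z (p *Z r)
*Z-distribˡ-+Z p q r t =
  trans (sumTo-cong′ t (λ i → ℤ.*-distribˡ-+ (p i) (q (t ∸ i)) (r (t ∸ i))))
        (sumTo-distrib-+ t _ _)

*Z-distribʳ-+Z : ∀ p q r → (q +Z r) *Z p ≗ (q *Z p) +Z (r *Z p)
*Z-distribʳ-+Z p q r t = trans (*Z-comm (q +Z r) p t)
  (trans (*Z-distribˡ-+Z p q r t) (cong₂ _+_ (*Z-comm p q t) (*Z-comm p r t)))

*Z-·Zʳ : ∀ c p q → p *Z (c ·Z q) ≗ c ·Z (p *Z q)
*Z-·Zʳ c p q t = trans (sumTo-cong′ t (λ i → x∙yz≈y∙xz (p i) c (q (t ∸ i)))) (sumTo-*ˡ t c _)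

*Z-shiftZʳ : ∀ p q → p *Z shiftZ q ≗ shiftZ (p *Z q)
*Z-shiftZʳ p q zero    = ℤ.*-zeroʳ (p zero)
*Z-shiftZʳ p q (suc t) = begin
  sumTo t (λ i → p i * shiftZ q (suc t ∸ i)) + p (suc t) * shiftZ q (t ∸ t)
    ≡⟨ cong₂ _+_ (sumTo-cong t (λ i i≤t → cong (λ k → p i * shiftZ q k) (ℕ.+-∸-assoc 1 i≤t)))
                 (trans (cong (λ k → p (suc t) * shiftZ q k) (ℕ.n∸n≡0 t)) (ℤ.*-zeroʳ (p (suc t)))) ⟩
  sumTo t (λ i → p i * q (t ∸ i)) + 0ℤ
    ≡⟨ ℤ.+-identityʳ _ ⟩
  sumTo t (λ i → p i * q (t ∸ i))    ∎
  where open ≡-Reasoning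

*Z-zeroˡ : ∀ q → zeroZ *Z q ≗ zeroZ
*Z-zeroˡ q t = sumTo-zero t (λ i → ℤ.*-zeroˡ (q (t ∸ i)))

*Z-zeroʳ : ∀ q → q *Z zeroZ ≗ zeroZ
*Z-zeroʳ q t = sumTo-zero t (λ i → ℤ.*-zeroʳ (q i))

NonNegZ-+Z : ∀ {p q} → NonNegZ p → NonNegZ q → NonNegZ (p +Z q)
NonNegZ-+Z p≥0 q≥0 t = +-nonNeg (p≥0 t) (q≥0 t)

NonNegZ-*Z : ∀ {p q} → NonNegZ p → NonNegZ q → NonNegZ (p *Z q)
NonNegZ-*Z p≥0 q≥0 t = sumTo-nonNeg t (λ i _ → *-nonNeg (p≥0 i) (q≥0 (t ∸ i)))

NonNegZ-shiftZ : ∀ {p} → NonNegZ p → NonNegZ (shiftZ p)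
NonNegZ-shiftZ p≥0 zero    = 0≤+ 0
NonNegZ-shiftZ p≥0 (suc t) = p≥0 t

mulLin-expand : ∀ m p → mulLin m p ≗ ((+ m) * (+ m)) ·Z p +Z (+ m) ·Z shiftZ p
mulLin-expand m p zero    = sym (trans (cong (_+_ ((+ m) * (+ m) * p zero)) (ℤ.*-zeroʳ (+ m)))
                                       (ℤ.+-identityʳ _))
mulLin-expand m p (suc t) = refl

mulLin-cong : ∀ m {p q} → p ≗ q → mulLin m p ≗ mulLin m q
mulLin-cong m p≗q zero    = cong ((+ m) * (+ m) *_) (p≗q zero)
mulLin-cong m p≗q (suc t) =
  cong₂ _+_ (cong ((+ m) * (+ m) *_) (p≗q (suc t))) (cong ((+ m) *_) (p≗q t))

mulLin-distrib-+Z : ∀ m p q → mulLin m (p +Z q) ≗ mulLin m p +Z mulLin m q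
mulLin-distrib-+Z m p q zero    = ℤ.*-distribˡ-+ ((+ m) * (+ m)) (p zero) (q zero)
mulLin-distrib-+Z m p q (suc t) = distrib (+ m) (p (suc t)) (q (suc t)) (p t) (q t)
  where
  distrib : ∀ m a b c d → m * m * (a + b) + m * (c + d) ≡ m * m * a + m * c + (m * m * b + m * d)
  distrib = solve-∀

mulLin-distrib--Z : ∀ m p q → mulLin m (p -Z q) ≗ mulLin m p -Z mulLin m q
mulLin-distrib--Z m p q zero    = distrib (+ m) (p zero) (q zero)
  where
  distrib : ∀ m a b → m * m * (a - b) ≡ m * m * a - m * m * b
  distrib = solve-∀
mulLin-distrib--Z m p q (suc t) = distrib (+ m) (p (suc t)) (q (suc t)) (p t) (q t)
  where
  distrib : ∀ m a b c d → m * m * (a - b) + m * (c - d) ≡ m * m * a + m * c - (m * m * b + m * d)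
  distrib = solve-∀

mulLin-comm : ∀ a b p → mulLin a (mulLin b p) ≗ mulLin b (mulLin a p)
mulLin-comm a b p zero          = commute (+ a) (+ b) (p 0)
  where
  commute : ∀ a b x → a * a * (b * b * x) ≡ b * b * (a * a * x)
  commute = solve-∀
mulLin-comm a b p (suc zero)    = commute (+ a) (+ b) (p 1) (p 0)
  where
  commute : ∀ a b x y → a * a * (b * b * x + b * y) + a * (b * b * y)
                      ≡ b * b * (a * a * x + a * y) + b * (a * a * y)
  commute = solve-∀
mulLin-comm a b p (suc (suc t)) = commute (+ a) (+ b) (p (suc (suc t))) (p (suc t)) (p t)
  where
  commute : ∀ a b x y z → a * a * (b * b * x + b * y) + a * (b * b * y + b * z)
                        ≡ b * b * (a * a * x + a * y) + b * (a * a * y + a * z)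
  commute = solve-∀

mulLin-zeroˡ : ∀ p → mulLin 0 p ≗ zeroZ
mulLin-zeroˡ p zero    = refl
mulLin-zeroˡ p (suc t) = refl

mulLin-zeroʳ : ∀ m → mulLin m zeroZ ≗ zeroZ
mulLin-zeroʳ m zero    = ℤ.*-zeroʳ ((+ m) * (+ m))
mulLin-zeroʳ m (suc t) = cong₂ _+_ (ℤ.*-zeroʳ ((+ m) * (+ m))) (ℤ.*-zeroʳ (+ m))

*Z-mulLinʳ : ∀ m p q → p *Z mulLin m q ≗ mulLin m (p *Z q)
*Z-mulLinʳ m p q t = begin
  (p *Z mulLin m q) t
    ≡⟨ *Z-cong {p} (λ _ → refl) (mulLin-expand m q) t ⟩
  (p *Z (m² ·Z q +Z (+ m) ·Z shiftZ q)) t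
    ≡⟨ *Z-distribˡ-+Z p (m² ·Z q) ((+ m) ·Z shiftZ q) t ⟩
  (p *Z (m² ·Z q)) t + (p *Z ((+ m) ·Z shiftZ q)) t
    ≡⟨ cong₂ _+_ (*Z-·Zʳ m² p q t)
                 (trans (*Z-·Zʳ (+ m) p (shiftZ q) t) (cong ((+ m) *_) (*Z-shiftZʳ p q t))) ⟩
  (m² ·Z (p *Z q) +Z (+ m) ·Z shiftZ (p *Z q)) t
    ≡⟨ sym (mulLin-expand m (p *Z q) t) ⟩
  mulLin m (p *Z q) t ∎
  where
  open ≡-Reasoning
  m² = (+ m) * (+ m)

*Z-mulLinˡ : ∀ m p q → mulLin m p *Z q ≗ mulLin m (p *Z q)
*Z-mulLinˡ m p q t = trans (*Z-comm (mulLin m p) q t)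
  (trans (*Z-mulLinʳ m q p t) (mulLin-cong m (*Z-comm q p) t))

*Z-expand-mulLin : ∀ p₁ p₂ q₁ q₂ a b t →
  ((p₁ +Z mulLin a p₂) *Z (q₁ +Z mulLin b q₂)) t ≡
  (p₁ *Z q₁) t + mulLin b (p₁ *Z q₂) t + mulLin a (p₂ *Z q₁) t + mulLin a (mulLin b (p₂ *Z q₂)) t
*Z-expand-mulLin p₁ p₂ q₁ q₂ a b t = begin
  ((p₁ +Z mulLin a p₂) *Z q) t
    ≡⟨ *Z-distribʳ-+Z q p₁ (mulLin a p₂) t ⟩
  (p₁ *Z q) t + (mulLin a p₂ *Z q) t
    ≡⟨ cong₂ _+_ (*Z-distribˡ-+Z p₁ q₁ (mulLin b q₂) t) (*Z-mulLinˡ a p₂ q t) ⟩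
  ((p₁ *Z q₁) t + (p₁ *Z mulLin b q₂) t) + mulLin a (p₂ *Z q) t
    ≡⟨ cong₂ _+_ (cong (_+_ ((p₁ *Z q₁) t)) (*Z-mulLinʳ b p₁ q₂ t)) p₂q-expanded ⟩
  ((p₁ *Z q₁) t + mulLin b (p₁ *Z q₂) t)
    + (mulLin a (p₂ *Z q₁) t + mulLin a (mulLin b (p₂ *Z q₂)) t)
    ≡⟨ sym (ℤ.+-assoc ((p₁ *Z q₁) t + mulLin b (p₁ *Z q₂) t) _ _) ⟩
  (p₁ *Z q₁) t + mulLin b (p₁ *Z q₂) t + mulLin a (p₂ *Z q₁) t + mulLin a (mulLin b (p₂ *Z q₂)) t ∎
  where
  open ≡-Reasoning
  q = q₁ +Z mulLin b q₂
  p₂q-expanded : mulLin a (p₂ *Z q) t ≡ mulLin a (p₂ *Z q₁) t + mulLin a (mulLin b (p₂ *Z q₂)) t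
  p₂q-expanded =
    trans (mulLin-cong a (λ t′ → trans (*Z-distribˡ-+Z p₂ q₁ (mulLin b q₂) t′)
                                       (cong (_+_ ((p₂ *Z q₁) t′)) (*Z-mulLinʳ b p₂ q₂ t′))) t)
          (mulLin-distrib-+Z a (p₂ *Z q₁) (mulLin b (p₂ *Z q₂)) t)

NonNegZ-mulLin : ∀ m {p} → NonNegZ p → NonNegZ (mulLin m p)
NonNegZ-mulLin m {p} p≥0 t = subst (0ℤ ≤ℤ_) (sym (mulLin-expand m p t))
  (+-nonNeg (*-nonNeg (*-nonNeg (0≤+ m) (0≤+ m)) (p≥0 t))
            (*-nonNeg (0≤+ m) (NonNegZ-shiftZ p≥0 t)))

-- b(b+z) − a(a+z) = (b−a)(b+a) + (b−a) z has nonnegative coefficients.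
mulLin-mono : ∀ {a b p} → a ≤ b → NonNegZ p → NonNegZ (mulLin b p -Z mulLin a p)
mulLin-mono {a} {b} {p} a≤b p≥0 t with ℕ.m≤n⇒∃[o]m+o≡n a≤b
... | d , refl = subst (0ℤ ≤ℤ_) (sym difference)
  (+-nonNeg (*-nonNeg (*-nonNeg (0≤+ d) (+-nonNeg (+-nonNeg (0≤+ a) (0≤+ a)) (0≤+ d))) (p≥0 t))
            (*-nonNeg (0≤+ d) (NonNegZ-shiftZ p≥0 t)))
  where
  open ≡-Reasoning
  square-difference : ∀ a d x y →
    (a + d) * (a + d) * x + (a + d) * y - (a * a * x + a * y) ≡ d * (a + a + d) * x + d * y
  square-difference = solve-∀
  difference : (mulLin (a ℕ.+ d) p -Z mulLin a p) t
             ≡ (+ d) * ((+ a) + (+ a) + (+ d)) * p t + (+ d) * shiftZ p t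
  difference = begin
    mulLin (a ℕ.+ d) p t - mulLin a p t
      ≡⟨ cong₂ _-_ (mulLin-expand (a ℕ.+ d) p t) (mulLin-expand a p t) ⟩
    + (a ℕ.+ d) * + (a ℕ.+ d) * p t + + (a ℕ.+ d) * shiftZ p t
      - ((+ a) * (+ a) * p t + (+ a) * shiftZ p t)
      ≡⟨ cong (λ k → k * k * p t + k * shiftZ p t - ((+ a) * (+ a) * p t + (+ a) * shiftZ p t))
              (ℤ.pos-+ a d) ⟩
    ((+ a) + (+ d)) * ((+ a) + (+ d)) * p t + ((+ a) + (+ d)) * shiftZ p t
      - ((+ a) * (+ a) * p t + (+ a) * shiftZ p t)
      ≡⟨ square-difference (+ a) (+ d) (p t) (shiftZ p t) ⟩
    (+ d) * ((+ a) + (+ a) + (+ d)) * p t + (+ d) * shiftZ p t ∎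

-- Row polynomials of triangles of polynomials in z

shiftY : (ℕ → PolyZ) → ℕ → PolyZ
shiftY c zero    = zeroZ
shiftY c (suc b) = c b

convolveY : (ℕ → PolyZ) → (ℕ → PolyZ) → ℕ → PolyZ
convolveY c d s t = sumTo s (λ j → (c j *Z d (s ∸ j)) t)

convolveY-shiftY-comm : ∀ c d s → convolveY c (shiftY d) s ≗ convolveY (shiftY c) d s
convolveY-shiftY-comm c d zero    t = trans (*Z-zeroʳ (c zero) t) (sym (*Z-zeroˡ (d zero) t))
convolveY-shiftY-comm c d (suc s) t = begin
  sumTo s (λ j → (c j *Z shiftY d (suc s ∸ j)) t) + (c (suc s) *Z shiftY d (s ∸ s)) t
    ≡⟨ cong₂ _+_ (sumTo-cong s (λ j j≤s → cong (λ k → (c j *Z shiftY d k) t) (ℕ.+-∸-assoc 1 j≤s)))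
                 (trans (cong (λ k → (c (suc s) *Z shiftY d k) t) (ℕ.n∸n≡0 s))
                        (*Z-zeroʳ (c (suc s)) t)) ⟩
  convolveY c d s t + 0ℤ
    ≡⟨ ℤ.+-comm (convolveY c d s t) 0ℤ ⟩
  0ℤ + convolveY c d s t
    ≡⟨ cong (_+ convolveY c d s t) (sym (*Z-zeroˡ (d (suc s)) t)) ⟩
  (zeroZ *Z d (suc s)) t + convolveY c d s t
    ≡⟨ sym (sumTo-suc-first s (λ j → (shiftY c j *Z d (suc s ∸ j)) t)) ⟩
  convolveY (shiftY c) d (suc s) t ∎
  where open ≡-Reasoning

module _ (T : ℕ → ℕ → PolyZ) (vanish : ∀ n j → n < j → T n j ≗ zeroZ) where

  rowPoly-coeff : ∀ n i j → rowPoly T n i j ≡ T n j i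
  rowPoly-coeff n i j with j ℕ.≤? n
  ... | yes _  = refl
  ... | no j≰n = sym (vanish n j (ℕ.≰⇒> j≰n) i)

  rowPoly-*P : ∀ m n t s → (rowPoly T m *P rowPoly T n) t s ≡ convolveY (T m) (T n) s t
  rowPoly-*P m n t s = trans
    (sumTo-cong′ t (λ i → sumTo-cong′ s (λ j →
       cong₂ _*_ (rowPoly-coeff m i j) (rowPoly-coeff n (t ∸ i) (s ∸ j)))))
    (sumTo-swap t s (λ i j → T m j i * T n (s ∸ j) (t ∸ i)))

-- The coefficient of z^t y^s in f_m f_{n+1} − f_{m+1} f_n for a triangle with
-- recurrence weight w.
recurrenceGap : (ℕ → ℕ → PolyZ) → (ℕ → ℕ → ℕ) → ℕ → ℕ → Poly2
recurrenceGap T w m n t s =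
  sumTo s (λ j → (mulLin (w n (s ∸ j)) (X j) -Z mulLin (w m j) (X j)) t)
  where
  X : ℕ → PolyZ
  X j = T m j *Z T n (s ∸ j)

module _ (T : ℕ → ℕ → PolyZ) (w : ℕ → ℕ → ℕ)
  (recurrence : ∀ n b → T (suc n) b ≗ shiftY (T n) b +Z mulLin (w n b) (T n b)) where

  convolveY-recurrence-gap : ∀ m n t s →
    convolveY (T m) (T (suc n)) s t - convolveY (T (suc m)) (T n) s t ≡ recurrenceGap T w m n t s
  convolveY-recurrence-gap m n t s = begin
    convolveY (T m) (T (suc n)) s t - convolveY (T (suc m)) (T n) s t
      ≡⟨ cong₂ _-_ (trans (sumTo-cong′ s expandʳ) (sumTo-distrib-+ s _ _))
                   (trans (sumTo-cong′ s expandˡ) (sumTo-distrib-+ s _ _)) ⟩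
    (convolveY (T m) (shiftY (T n)) s t + C) - (convolveY (shiftY (T m)) (T n) s t + D)
      ≡⟨ cong (λ k → (k + C) - (convolveY (shiftY (T m)) (T n) s t + D))
              (convolveY-shiftY-comm (T m) (T n) s t) ⟩
    (convolveY (shiftY (T m)) (T n) s t + C) - (convolveY (shiftY (T m)) (T n) s t + D)
      ≡⟨ cancel (convolveY (shiftY (T m)) (T n) s t) C D ⟩
    C - D
      ≡⟨ sym (sumTo-distrib-- s _ _) ⟩
    recurrenceGap T w m n t s ∎
    where
    open ≡-Reasoning
    cancel : ∀ a c d → (a + c) - (a + d) ≡ c - d
    cancel = solve-∀
    X : ℕ → PolyZ
    X j = T m j *Z T n (s ∸ j)
    C = sumTo s (λ j → mulLin (w n (s ∸ j)) (X j) t)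
    D = sumTo s (λ j → mulLin (w m j) (X j) t)
    expandʳ : ∀ j → (T m j *Z T (suc n) (s ∸ j)) t
                  ≡ (T m j *Z shiftY (T n) (s ∸ j)) t + mulLin (w n (s ∸ j)) (X j) t
    expandʳ j = trans (*Z-cong {T m j} (λ _ → refl) (recurrence n (s ∸ j)) t)
      (trans (*Z-distribˡ-+Z (T m j) (shiftY (T n) (s ∸ j)) (mulLin (w n (s ∸ j)) (T n (s ∸ j))) t)
             (cong (_+_ ((T m j *Z shiftY (T n) (s ∸ j)) t))
                   (*Z-mulLinʳ _ (T m j) (T n (s ∸ j)) t)))
    expandˡ : ∀ j → (T (suc m) j *Z T n (s ∸ j)) t
                  ≡ (shiftY (T m) j *Z T n (s ∸ j)) t + mulLin (w m j) (X j) t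
    expandˡ j = trans (*Z-cong {q = T n (s ∸ j)} (recurrence m j) (λ _ → refl) t)
      (trans (*Z-distribʳ-+Z (T n (s ∸ j)) (shiftY (T m) j) (mulLin (w m j) (T m j)) t)
             (cong (_+_ ((shiftY (T m) j *Z T n (s ∸ j)) t))
                   (*Z-mulLinˡ _ (T m j) (T n (s ∸ j)) t)))

rowPoly-stronglyLogConvex : ∀ (T : ℕ → ℕ → PolyZ) (w : ℕ → ℕ → ℕ) →
  (∀ n j → n < j → T n j ≗ zeroZ) →
  (∀ n j → NonNegZ (T n j)) →
  (∀ n b → T (suc n) b ≗ shiftY (T n) b +Z mulLin (w n b) (T n b)) →
  (∀ m n → m ≤ n → Nonneg (recurrenceGap T w m n)) →
  StronglyLogConvex (rowPoly T)
rowPoly-stronglyLogConvex T w vanish T≥0 recurrence gap≥0 = rows≥0 , logConvex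
  where
  rows≥0 : ∀ n → Nonneg (rowPoly T n)
  rows≥0 n i j = subst (0ℤ ≤ℤ_) (sym (rowPoly-coeff T vanish n i j)) (T≥0 n j i)
  logConvex : ∀ k l → 1 ≤ k → k ≤ l →
    Nonneg ((rowPoly T (k ∸ 1) *P rowPoly T (suc l)) -P (rowPoly T k *P rowPoly T l))
  logConvex (suc m) n _ m<n t s = subst (0ℤ ≤ℤ_)
    (sym (trans (cong₂ _-_ (rowPoly-*P T vanish m (suc n) t s) (rowPoly-*P T vanish (suc m) n t s))
                (convolveY-recurrence-gap T w recurrence m n t s)))
    (gap≥0 m n (ℕ.<⇒≤ m<n) t s)

-- Jacobi-Stirling numbers of the second kind

JS-vanish : ∀ n j → n < j → JS n j ≗ zeroZ
JS-vanish zero    (suc j) _         t = refl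
JS-vanish (suc n) (suc j) (s≤s n<j) t = cong₂ _+_ (JS-vanish n j n<j t)
  (trans (mulLin-cong (suc j) (JS-vanish n (suc j) (ℕ.m≤n⇒m≤1+n n<j)) t) (mulLin-zeroʳ (suc j) t))

JS-nonNeg : ∀ n j → NonNegZ (JS n j)
JS-nonNeg zero    zero    zero    = 0≤+ 1
JS-nonNeg zero    zero    (suc t) = 0≤+ 0
JS-nonNeg zero    (suc j) t       = 0≤+ 0
JS-nonNeg (suc n) zero    t       = 0≤+ 0
JS-nonNeg (suc n) (suc j)         =
  NonNegZ-+Z (JS-nonNeg n j) (NonNegZ-mulLin (suc j) (JS-nonNeg n (suc j)))

JS-recurrence : ∀ n b → JS (suc n) b ≗ shiftY (JS n) b +Z mulLin b (JS n b)
JS-recurrence n zero    t = sym (trans (ℤ.+-identityˡ _) (mulLin-zeroˡ (JS n zero) t))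
JS-recurrence n (suc b) t = refl

JS-minor : ℕ → ℕ → ℕ → ℕ → PolyZ
JS-minor m n a b = JS m a *Z JS n b -Z JS m b *Z JS n a

JS-minor-suc : ∀ m n a b t →
  JS-minor (suc m) (suc n) (suc a) (suc b) t
  ≡ JS-minor m n a b t + mulLin (suc b) (JS-minor m n a (suc b)) t
    + mulLin (suc a) (JS-minor m n (suc a) b) t
    + mulLin (suc a) (mulLin (suc b) (JS-minor m n (suc a) (suc b))) t
JS-minor-suc m n a b t = begin
  JS-minor (suc m) (suc n) (suc a) (suc b) t
    ≡⟨ cong₂ _-_ (*Z-expand-mulLin A₁ A₂ B₁ B₂ (suc a) (suc b) t)
                 (trans (*Z-expand-mulLin C₁ C₂ E₁ E₂ (suc b) (suc a) t)
                        (cong (_+_ (c₁ + c₃ + c₂)) (mulLin-comm (suc b) (suc a) (C₂ *Z E₂) t))) ⟩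
  (a₁ + a₂ + a₃ + a₄) - (c₁ + c₃ + c₂ + c₄)
    ≡⟨ regroup a₁ a₂ a₃ a₄ c₁ c₂ c₃ c₄ ⟩
  (a₁ - c₁) + (a₂ - c₂) + (a₃ - c₃) + (a₄ - c₄)
    ≡⟨ sym (cong₂ _+_ (cong₂ _+_ (cong (_+_ (a₁ - c₁)) minor₂) minor₃) minor₄) ⟩
  JS-minor m n a b t + mulLin (suc b) (JS-minor m n a (suc b)) t
    + mulLin (suc a) (JS-minor m n (suc a) b) t
    + mulLin (suc a) (mulLin (suc b) (JS-minor m n (suc a) (suc b))) t ∎
  where
  open ≡-Reasoning
  regroup : ∀ a₁ a₂ a₃ a₄ c₁ c₂ c₃ c₄ →
    (a₁ + a₂ + a₃ + a₄) - (c₁ + c₃ + c₂ + c₄) ≡ (a₁ - c₁) + (a₂ - c₂) + (a₃ - c₃) + (a₄ - c₄)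
  regroup = solve-∀
  A₁ = JS m a ; A₂ = JS m (suc a) ; B₁ = JS n b ; B₂ = JS n (suc b)
  C₁ = JS m b ; C₂ = JS m (suc b) ; E₁ = JS n a ; E₂ = JS n (suc a)
  a₁ = (A₁ *Z B₁) t ; a₂ = mulLin (suc b) (A₁ *Z B₂) t
  a₃ = mulLin (suc a) (A₂ *Z B₁) t ; a₄ = mulLin (suc a) (mulLin (suc b) (A₂ *Z B₂)) t
  c₁ = (C₁ *Z E₁) t ; c₂ = mulLin (suc b) (C₂ *Z E₁) t
  c₃ = mulLin (suc a) (C₁ *Z E₂) t ; c₄ = mulLin (suc a) (mulLin (suc b) (C₂ *Z E₂)) t
  minor₂ : mulLin (suc b) (JS-minor m n a (suc b)) t ≡ a₂ - c₂
  minor₂ = mulLin-distrib--Z (suc b) (A₁ *Z B₂) (C₂ *Z E₁) t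
  minor₃ : mulLin (suc a) (JS-minor m n (suc a) b) t ≡ a₃ - c₃
  minor₃ = mulLin-distrib--Z (suc a) (A₂ *Z B₁) (C₁ *Z E₂) t
  minor₄ : mulLin (suc a) (mulLin (suc b) (JS-minor m n (suc a) (suc b))) t ≡ a₄ - c₄
  minor₄ = trans (mulLin-cong (suc a) (mulLin-distrib--Z (suc b) (A₂ *Z B₂) (C₂ *Z E₂)) t)
                 (mulLin-distrib--Z (suc a) (mulLin (suc b) (A₂ *Z B₂)) (mulLin (suc b) (C₂ *Z E₂)) t)

mutual
  JS-minor-nonNeg : ∀ {m n a b} → m ≤ n → a ≤ b → NonNegZ (JS-minor m n a b)
  JS-minor-nonNeg {m} {n} {a} m≤n a≤b with ℕ.m≤n⇒m<n∨m≡n a≤b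
  ... | inj₁ a<b  = JS-minor-nonNeg-< m≤n a<b
  ... | inj₂ refl = λ t → subst (0ℤ ≤ℤ_) (sym (ℤ.+-inverseʳ ((JS m a *Z JS n a) t))) (0≤+ 0)

  JS-minor-nonNeg-< : ∀ {m n a b} → m ≤ n → a < b → NonNegZ (JS-minor m n a b)
  JS-minor-nonNeg-< {zero} {n} {a} {suc b} _ _ t =
    subst (0ℤ ≤ℤ_) (sym (trans (cong ((JS zero a *Z JS n (suc b)) t -_) (*Z-zeroˡ (JS n a) t))
                               (ℤ.+-identityʳ _)))
          (NonNegZ-*Z (JS-nonNeg zero a) (JS-nonNeg n (suc b)) t)
  JS-minor-nonNeg-< {suc m} {suc n} {zero} {b} _ _ t =
    subst (0ℤ ≤ℤ_) (sym (cong₂ _-_ (*Z-zeroˡ (JS (suc n) b) t) (*Z-zeroʳ (JS (suc m) b) t))) (0≤+ 0)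
  JS-minor-nonNeg-< {suc m} {suc n} {suc a} {suc b} (s≤s m≤n) (s≤s a<b) t =
    subst (0ℤ ≤ℤ_) (sym (JS-minor-suc m n a b t))
      (+-nonNeg (+-nonNeg (+-nonNeg
        (JS-minor-nonNeg m≤n (ℕ.<⇒≤ a<b) t)
        (NonNegZ-mulLin (suc b) (JS-minor-nonNeg m≤n (ℕ.m≤n⇒m≤1+n (ℕ.<⇒≤ a<b))) t))
        (NonNegZ-mulLin (suc a) (JS-minor-nonNeg m≤n a<b) t))
        (NonNegZ-mulLin (suc a) (NonNegZ-mulLin (suc b) (JS-minor-nonNeg m≤n (s≤s (ℕ.<⇒≤ a<b)))) t))

JS-gap-nonNeg : ∀ m n → m ≤ n → Nonneg (recurrenceGap JS (λ _ b → b) m n)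
JS-gap-nonNeg m n m≤n t s =
  sumTo-nonNeg-symmetric s (λ j → term j (s ∸ j)) (λ j j≤s →
    subst (λ k → 0ℤ ≤ℤ term j (s ∸ j) + term (s ∸ j) k) (sym (ℕ.m∸[m∸n]≡n j≤s)) (pair j (s ∸ j)))
  where
  term : ℕ → ℕ → ℤ
  term a b = (mulLin b (JS m a *Z JS n b) -Z mulLin a (JS m a *Z JS n b)) t

  term-pair : ∀ a b →
    term a b + term b a ≡ (mulLin b (JS-minor m n a b) -Z mulLin a (JS-minor m n a b)) t
  term-pair a b = begin
    term a b + term b a
      ≡⟨ regroup (mulLin b P t) (mulLin a P t) (mulLin b Q t) (mulLin a Q t) ⟩
    (mulLin b P t - mulLin b Q t) - (mulLin a P t - mulLin a Q t)
      ≡⟨ sym (cong₂ _-_ (mulLin-distrib--Z b P Q t) (mulLin-distrib--Z a P Q t)) ⟩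
    (mulLin b (JS-minor m n a b) -Z mulLin a (JS-minor m n a b)) t ∎
    where
    open ≡-Reasoning
    regroup : ∀ bP aP bQ aQ → (bP - aP) + (aQ - bQ) ≡ (bP - bQ) - (aP - aQ)
    regroup = solve-∀
    P = JS m a *Z JS n b
    Q = JS m b *Z JS n a

  pair-ordered : ∀ {a b} → a ≤ b → 0ℤ ≤ℤ term a b + term b a
  pair-ordered {a} {b} a≤b = subst (0ℤ ≤ℤ_) (sym (term-pair a b))
    (mulLin-mono a≤b (JS-minor-nonNeg m≤n a≤b) t)

  pair : ∀ a b → 0ℤ ≤ℤ term a b + term b a
  pair a b with ℕ.≤-total a b
  ... | inj₁ a≤b = pair-ordered a≤b
  ... | inj₂ b≤a = subst (0ℤ ≤ℤ_) (ℤ.+-comm (term b a) (term a b)) (pair-ordered b≤a)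

JS-stronglyLogConvex : StronglyLogConvex (rowPoly JS)
JS-stronglyLogConvex =
  rowPoly-stronglyLogConvex JS (λ _ b → b) JS-vanish JS-nonNeg JS-recurrence JS-gap-nonNeg

-- Jacobi-Stirling numbers of the first kind

js-vanish : ∀ n j → n < j → js n j ≗ zeroZ
js-vanish zero    (suc j) _         t = refl
js-vanish (suc n) (suc j) (s≤s n<j) t = cong₂ _+_ (js-vanish n j n<j t)
  (trans (mulLin-cong n (js-vanish n (suc j) (ℕ.m≤n⇒m≤1+n n<j)) t) (mulLin-zeroʳ n t))

js-nonNeg : ∀ n j → NonNegZ (js n j)
js-nonNeg zero    zero    zero    = 0≤+ 1
js-nonNeg zero    zero    (suc t) = 0≤+ 0
js-nonNeg zero    (suc j) t       = 0≤+ 0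
js-nonNeg (suc n) zero    t       = 0≤+ 0
js-nonNeg (suc n) (suc j)         =
  NonNegZ-+Z (js-nonNeg n j) (NonNegZ-mulLin n (js-nonNeg n (suc j)))

js-recurrence : ∀ n b → js (suc n) b ≗ shiftY (js n) b +Z mulLin n (js n b)
js-recurrence zero    zero    t = sym (trans (ℤ.+-identityˡ _) (mulLin-zeroˡ (js zero zero) t))
js-recurrence (suc n) zero    t = sym (trans (ℤ.+-identityˡ _) (mulLin-zeroʳ (suc n) t))
js-recurrence n       (suc b) t = refl

js-gap-nonNeg : ∀ m n → m ≤ n → Nonneg (recurrenceGap js (λ n _ → n) m n)
js-gap-nonNeg m n m≤n t s = sumTo-nonNeg s (λ j _ →
  mulLin-mono m≤n (NonNegZ-*Z (js-nonNeg m j) (js-nonNeg n (s ∸ j))) t)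

js-stronglyLogConvex : StronglyLogConvex (rowPoly js)
js-stronglyLogConvex =
  rowPoly-stronglyLogConvex js (λ n _ → n) js-vanish js-nonNeg js-recurrence js-gap-nonNeg

theorem1p4 : StronglyLogConvex (rowPoly JS) × StronglyLogConvex (rowPoly js)
theorem1p4 = JS-stronglyLogConvex , js-stronglyLogConvex
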